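{- Let $N=(P,T_1,T_2,W,I)$ be a Petri net game and $t\in T$ a transition. If $t^{\oplus}\cap{}^\bullet T_2=\emptyset$ and $t^{\ominus}\cap{}^\circ T_2=\emptyset$, then $t$ is safe in every marking $M$ of $N$ (i.e. $t\in\mathit{safe}(M)$ for every marking $M$ with $en_2(M)=\emptyset$ and $t\in en_1(M)$).
   Context: A Petri net game is $N=(P,T_1,T_2,W,I)$ with finite disjoint sets of places $P$ and transitions $T=T_1\uplus T_2$ (player 1 and player 2 transitions), $W:(P\times T)\cup(T\times P)\to\mathbb{N}_0$ and $I:P\times T\to\mathbb{N}\cup\{\infty\}$. A marking is $M:P\to\mathbb{N}_0$; $t$ is enabled in $M$ iff $M(p)\ge W(p,t)$ and $M(p)<I(p,t)$ for all $p\in P$, and then $M\xrightarrow{t}M'$ with $M'(p)=M(p)-W(p,t)+W(t,p)$; extend to sequences. $en_i(M)$ is the set of enabled transitions of $T_i$. Notation: ${}^\bullet t=\{p\mid W(p,t)>0\}$, ${}^\circ t=\{p\mid I(p,t)\ne\infty\}$, extended to sets of transitions by union (so ${}^\bullet T_2=\bigcup_{t'\in T_2}{}^\bullet t'$, ${}^\circ T_2=\bigcup_{t'\in T_2}{}^\circ t'$); $t^{\ominus}=\{p\in{}^\bullet t\mid W(p,t)>W(t,p)\}$ (places whose token count $t$ decreases), $t^{\oplus}=\{p\in t^\bullet\mid W(p,t)<W(t,p)\}$ where $t^\bullet=\{p\mid W(t,p)>0\}$ (places whose token count $t$ increases). For a marking $M$ with $en_2(M)=\emptyset$, a transition $t\in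 en_1(M)$ is safe in $M$ (written $t\in\mathit{safe}(M)$) if for every $w\in(T_1\setminus\{t\})^*$ such that $M\xrightarrow{w}M_1$ with $en_2(M_1)=\emptyset$ and $M\xrightarrow{tw}M_2$, we have $en_2(M_2)=\emptyset$. -}

module Defs where

open import Data.Nat using (ℕ; _≤_; _<_; _>_; _+_; _∸_)
open import Data.Fin using (Fin)
open import Data.Maybe using (Maybe; just; nothing)
open import Data.List using (List; []; _∷_)
open import Data.List.Relation.Unary.All using (All)
open import Data.Product using (Σ; ∃; _×_; _,_)
open import Data.Empty using (⊥)
open import Data.Unit using (⊤)
open import Relation.Binary.PropositionalEquality using (_≡_; _≢_)
open import Relation.Nullary using (¬_)

data Player : Set where
  P1 P2 : Player

-- Inhibitor weights: nothing = ∞, just k = k (the paper has k ∈ ℕ, i.e. k ≥ 1;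
-- allowing k = 0 only adds nets in which a transition is never enabled).
ℕ∞ : Set
ℕ∞ = Maybe ℕ

_<∞_ : ℕ → ℕ∞ → Set
n <∞ nothing = ⊤
n <∞ just k  = n < k

-- A Petri net game with places Fin np and transitions Fin nt;
-- T₁ / T₂ are given by the owner function.
record PNGame (np nt : ℕ) : Set where
  field
    owner : Fin nt → Player
    Wpre  : Fin np → Fin nt → ℕ
    Wpost : Fin nt → Fin np → ℕ
    I     : Fin np → Fin nt → ℕ∞

module _ {np nt : ℕ} (N : PNGame np nt) where
  open PNGame N

  Marking : Set
  Marking = Fin np → ℕ

  _∈T₁ : Fin nt → Set
  t ∈T₁ = owner t ≡ P1

  _∈T₂ : Fin nt → Set
  t ∈T₂ = owner t ≡ P2

  Enabled : Marking → Fin nt → Set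
  Enabled M t = ∀ p → Wpre p t ≤ M p × M p <∞ I p t

  _∈en₁_ : Fin nt → Marking → Set
  t ∈en₁ M = t ∈T₁ × Enabled M t

  _∈en₂_ : Fin nt → Marking → Set
  t ∈en₂ M = t ∈T₂ × Enabled M t

  en₂-empty : Marking → Set
  en₂-empty M = ∀ t → ¬ (t ∈en₂ M)

  Fires : Marking → Fin nt → Marking → Set
  Fires M t M' = Enabled M t × (∀ p → M' p ≡ (M p ∸ Wpre p t) + Wpost t p)

  data FiresSeq : Marking → List (Fin nt) → Marking → Set where
    []  : ∀ {M} → FiresSeq M [] M
    _∷_ : ∀ {M M₁ M₂ t w} → Fires M t M₁ → FiresSeq M₁ w M₂ → FiresSeq M (t ∷ w) M₂

  _∈pre_ : Fin np → Fin nt → Set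
  p ∈pre t = Wpre p t > 0

  _∈inh_ : Fin np → Fin nt → Set
  p ∈inh t = I p t ≢ nothing

  _∈preT₂ : Fin np → Set
  p ∈preT₂ = ∃ λ t' → t' ∈T₂ × p ∈pre t'

  _∈inhT₂ : Fin np → Set
  p ∈inhT₂ = ∃ λ t' → t' ∈T₂ × p ∈inh t'

  _∈⊖_ : Fin np → Fin nt → Set
  p ∈⊖ t = p ∈pre t × Wpre p t > Wpost t p

  _∈⊕_ : Fin np → Fin nt → Set
  p ∈⊕ t = Wpost t p > 0 × Wpre p t < Wpost t p

  Safe : Marking → Fin nt → Set
  Safe M t =
    en₂-empty M × t ∈en₁ M ×
    (∀ (w : List (Fin nt)) → All (λ u → u ∈T₁ × u ≢ t) w →
       ∀ M₁ M₂ → FiresSeq M w M₁ → en₂-empty M₁ → FiresSeq M (t ∷ w) M₂ →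
       en₂-empty M₂)

module Submission where

-- Let M --w--> M₁ and M --t w--> M₂.  Firing a transition u
-- changes every place by the same amount W(u,p) - W(p,u) regardless of the
-- marking it fires in, so the two runs stay a constant "offset" apart:
-- for every place p,  M₂ p + W(p,t) = M₁ p + W(t,p)  (M₂ is M₁ shifted by the
-- effect of t).  Now let u ∈ T₂ be enabled in M₂ and inspect a place p:
--   * t increases p: then M₁ p ≤ M₂ p, so the inhibitor bound of u transfers
--     down to M₁, and p ∉ •u (as t⊕ ∩ •T₂ = ∅), so u needs no token there;
--   * t decreases p: then M₂ p ≤ M₁ p, so the token bound transfers up to
--     M₁, and p ∉ °u (as t⊖ ∩ °T₂ = ∅), so u has no inhibitor there;
--   * t leaves p unchanged: then M₁ p = M₂ p.
-- Hence u is enabled in M₁, contradicting en₂(M₁) = ∅.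

open import Defs
open import Data.Nat using (ℕ; _+_; _∸_; _≤_; z≤n)
open import Data.Nat.Properties
  using (≤-reflexive; ≤-trans; ≤-<-trans; ≤-antisym; <⇒≤; ≮⇒≥; <-cmp; +-monoʳ-≤; +-cancelʳ-≤;
         +-cancelʳ-≡; m∸n+n≡m; +-commutativeSemigroup)
open import Algebra.Properties.CommutativeSemigroup +-commutativeSemigroup
  using (xy∙z≈xz∙y)
open import Data.Fin using (Fin)
open import Data.Product using (_×_; _,_; proj₁)
open import Data.List using (_∷_)
open import Data.List.Relation.Unary.All using (All)
open import Data.Maybe using (just; nothing)
open import Data.Unit using (tt)
open import Data.Empty using (⊥-elim)
open import Relation.Nullary using (¬_)
open import Relation.Binary using (tri<; tri≈; tri>)
open import Relation.Binary.PropositionalEquality using (_≡_; _≢_; sym; cong; subst; module ≡-Reasoning)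
open ≡-Reasoning

consume-produce : ∀ {m x} y → x ≤ m → (m ∸ x) + y + x ≡ m + y
consume-produce {m} {x} y x≤m = begin
  (m ∸ x) + y + x   ≡⟨ xy∙z≈xz∙y (m ∸ x) y x ⟩
  (m ∸ x) + x + y   ≡⟨ cong (_+ y) (m∸n+n≡m x≤m) ⟩
  m + y             ∎

balance-update : ∀ {a b c d x} y → x ≤ a → x ≤ b → b + c ≡ a + d →
                 (b ∸ x) + y + c ≡ (a ∸ x) + y + d
balance-update {a} {b} {c} {d} {x} y x≤a x≤b balance = +-cancelʳ-≡ x _ _ (begin
  (b ∸ x) + y + c + x   ≡⟨ xy∙z≈xz∙y ((b ∸ x) + y) c x ⟩
  (b ∸ x) + y + x + c   ≡⟨ cong (_+ c) (consume-produce y x≤b) ⟩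
  b + y + c             ≡⟨ xy∙z≈xz∙y b y c ⟩
  b + c + y             ≡⟨ cong (_+ y) balance ⟩
  a + d + y             ≡⟨ xy∙z≈xz∙y a d y ⟩
  a + y + d             ≡⟨ cong (_+ d) (sym (consume-produce y x≤a)) ⟩
  (a ∸ x) + y + x + d   ≡⟨ xy∙z≈xz∙y ((a ∸ x) + y) x d ⟩
  (a ∸ x) + y + d + x   ∎)

balance-≤ : ∀ {a b c d} → b + c ≡ a + d → c ≤ d → a ≤ b
balance-≤ {a} {b} {c} {d} balance c≤d =
  +-cancelʳ-≤ c a b (subst (a + c ≤_) (sym balance) (+-monoʳ-≤ a c≤d))

<∞-antitone : ∀ {m n} i → m ≤ n → n <∞ i → m <∞ i
<∞-antitone nothing  _   _   = tt
<∞-antitone (just k) m≤n n<k = ≤-<-trans m≤n n<k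

no-inhibitor : ∀ {i} m → ¬ (i ≢ nothing) → m <∞ i
no-inhibitor {nothing} m _          = tt
no-inhibitor {just k}  m inhibited = ⊥-elim (inhibited λ ())

module _ {np nt : ℕ} (N : PNGame np nt) (t : Fin nt) where
  open PNGame N

  -- B is A shifted by the effect of t:  B p - A p = W(t,p) - W(p,t)  for all p.
  ShiftedBy-t : Marking N → Marking N → Set
  ShiftedBy-t A B = ∀ p → B p + Wpre p t ≡ A p + Wpost t p

  fire-t-shifts : ∀ {M M'} → Fires N M t M' → ShiftedBy-t M M'
  fire-t-shifts {M} {M'} (enabled , update) p = begin
    M' p + Wpre p t                           ≡⟨ cong (_+ Wpre p t) (update p) ⟩
    (M p ∸ Wpre p t) + Wpost t p + Wpre p t   ≡⟨ consume-produce (Wpost t p) (proj₁ (enabled p)) ⟩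
    M p + Wpost t p                           ∎

  fire-preserves-shift : ∀ {A A' B B' u} → ShiftedBy-t A B →
                         Fires N A u A' → Fires N B u B' → ShiftedBy-t A' B'
  fire-preserves-shift {A} {A'} {B} {B'} {u} shifted (enA , updA) (enB , updB) p = begin
    B' p + Wpre p t                           ≡⟨ cong (_+ Wpre p t) (updB p) ⟩
    (B p ∸ Wpre p u) + Wpost u p + Wpre p t   ≡⟨ balance-update (Wpost u p)
                                                    (proj₁ (enA p)) (proj₁ (enB p)) (shifted p) ⟩
    (A p ∸ Wpre p u) + Wpost u p + Wpost t p  ≡⟨ cong (_+ Wpost t p) (sym (updA p)) ⟩
    A' p + Wpost t p                          ∎

  fireSeq-preserves-shift : ∀ {A A' B B' w} → ShiftedBy-t A B →
                            FiresSeq N A w A' → FiresSeq N B w B' → ShiftedBy-t A' B'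
  fireSeq-preserves-shift shifted []         []         = shifted
  fireSeq-preserves-shift shifted (fA ∷ sA) (fB ∷ sB) =
    fireSeq-preserves-shift (fire-preserves-shift shifted fA fB) sA sB

  shift-reflects-T₂-enabling :
    (∀ p → ¬ (_∈⊕_ N p t × _∈preT₂ N p)) →
    (∀ p → ¬ (_∈⊖_ N p t × _∈inhT₂ N p)) →
    ∀ {A B u} → ShiftedBy-t A B → _∈T₂ N u → Enabled N B u → Enabled N A u
  shift-reflects-T₂-enabling no⊕pre no⊖inh {A} {B} {u} shifted u∈T₂ enabledB p
    with enabledB p | <-cmp (Wpre p t) (Wpost t p)
  ... | tokens , below | tri< pre<post _ _ = no-token-needed , <∞-antitone (I p u) A≤B below
    where
    A≤B : A p ≤ B p
    A≤B = balance-≤ (shifted p) (<⇒≤ pre<post)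
    p∈⊕t : _∈⊕_ N p t
    p∈⊕t = ≤-<-trans z≤n pre<post , pre<post
    no-token-needed : Wpre p u ≤ A p
    no-token-needed = ≤-trans (≮⇒≥ λ p∈•u → no⊕pre p (p∈⊕t , u , u∈T₂ , p∈•u)) z≤n
  ... | tokens , below | tri≈ _ pre≡post _ = subst (λ n → Wpre p u ≤ n × n <∞ I p u) B≡A (tokens , below)
    where
    B≡A : B p ≡ A p
    B≡A = ≤-antisym (balance-≤ (sym (shifted p)) (≤-reflexive (sym pre≡post)))
                    (balance-≤ (shifted p) (≤-reflexive pre≡post))
  ... | tokens , below | tri> _ _ post<pre = ≤-trans tokens B≤A , no-inhibitor (A p) λ p∈°u →
    no⊖inh p ((≤-<-trans z≤n post<pre , post<pre) , u , u∈T₂ , p∈°u)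
    where
    B≤A : B p ≤ A p
    B≤A = balance-≤ (sym (shifted p)) (<⇒≤ post<pre)

lemma4p6 : ∀ {np nt} (N : PNGame np nt) (t : Fin nt) →
    (∀ p → ¬ (_∈⊕_ N p t × _∈preT₂ N p)) →
    (∀ p → ¬ (_∈⊖_ N p t × _∈inhT₂ N p)) →
    ∀ (M : Marking N) → en₂-empty N M → _∈en₁_ N t M → Safe N M t
lemma4p6 N t no⊕pre no⊖inh M en₂M-empty t∈en₁M = en₂M-empty , t∈en₁M , t-safe
  where
  -- The argument
  -- works for every w.
  t-safe : ∀ w → All (λ u → _∈T₁ N u × u ≢ t) w →
           ∀ M₁ M₂ → FiresSeq N M w M₁ → en₂-empty N M₁ →
           FiresSeq N M (t ∷ w) M₂ → en₂-empty N M₂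
  t-safe w _ M₁ M₂ M-w→M₁ en₂M₁-empty (M-t→M' ∷ M'-w→M₂) u (u∈T₂ , enabledM₂) =
    en₂M₁-empty u (u∈T₂ , shift-reflects-T₂-enabling N t no⊕pre no⊖inh shifted u∈T₂ enabledM₂)
    where
    shifted : ShiftedBy-t N t M₁ M₂
    shifted = fireSeq-preserves-shift N t (fire-t-shifts N t M-t→M') M-w→M₁ M'-w→M₂
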